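{- Let $n = p^k m^2$ be an odd perfect number, where $p$ is prime, $p \equiv k \equiv 1 \pmod 4$ and $\gcd(p,m)=1$. If $\sigma(m^2)/p^k$ is a perfect square, then $p \geq 17$.
   Context: $\sigma(z)$ denotes the sum of the positive divisors of $z$. An odd perfect number is an odd positive integer $n$ with $\sigma(n) = 2n$. By Euler, any odd perfect number has the form $n = p^k m^2$ with $p$ prime, $p \equiv k \equiv 1 \pmod 4$ and $\gcd(p,m)=1$; $p$ is called the special prime. (For such $n$, $\sigma(m^2)/p^k$ is an integer.) -}

module Defs where

open import Data.Nat using (ℕ; suc)
open import Data.Nat.ListAction using (sum)
open import Data.List using (filter; upTo; map)
open import Data.Nat.Divisibility using (_∣?_)

σ : ℕ → ℕ
σ z = sum (filter (_∣? z) (map suc (upTo z)))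

{-# OPTIONS --safe #-}
module Submission where

open import Defs
open import Data.Bool using (if_then_else_)
open import Data.Empty using (⊥-elim)
open import Data.List using ([]; _∷_; filter; upTo; map; _∷ʳ_; [_])
open import Data.List.Properties using (upTo-∷ʳ; map-++)
open import Data.Nat
open import Data.Nat.Coprimality using (Coprime; coprime-divisor; gcd≡1⇒coprime)
open import Data.Nat.DivMod
open import Data.Nat.Divisibility
open import Data.Nat.GCD using (gcd)
open import Data.Nat.ListAction using (sum)
open import Data.Nat.ListAction.Properties using (sum-++)
open import Data.Nat.Primality
open import Data.Nat.Properties
open import Algebra.Properties.CommutativeSemigroup *-commutativeSemigroup using (x∙yz≈y∙xz)
open import Data.Nat.Tactic.RingSolver using (solve-∀)
open import Data.Product using (∃; _,_)
open import Data.Sum using (_⊎_; inj₁; inj₂)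
open import Relation.Binary.PropositionalEquality hiding ([_])
open import Relation.Nullary
open import Relation.Nullary.Decidable using (_→-dec_; from-yes; from-no)

-- Write n = p^k x with x = m², so p ∤ x and σ n = (1 + p + ⋯ + p^k) σ x. Then σ n = 2n
-- and σ x = p^k s² give (1 + p + ⋯ + p^k) s² = 2x, and reducing mod p gives s² ≡ 2m²
-- with p ∤ m: 2 is a quadratic residue mod p. The only primes p ≡ 1 (mod 4) below 17
-- are 5 and 13, and 2 is a non-residue modulo both (a finite check).

sumTo : ℕ → (ℕ → ℕ) → ℕ
sumTo zero    f = 0
sumTo (suc N) f = sumTo N f + f (suc N)

divisorTerm : ℕ → ℕ → ℕ
divisorTerm z d = if does (d ∣? z) then d else 0

onMultiplesOf : ℕ → (ℕ → ℕ) → ℕ → ℕ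
onMultiplesOf c f d = if does (c ∣? d) then f d else 0

sum-filter-∣≡sum-divisorTerm : ∀ z ds → sum (filter (_∣? z) ds) ≡ sum (map (divisorTerm z) ds)
sum-filter-∣≡sum-divisorTerm z []       = refl
sum-filter-∣≡sum-divisorTerm z (d ∷ ds) with d ∣? z
... | yes _ = cong (d +_) (sum-filter-∣≡sum-divisorTerm z ds)
... | no  _ = sum-filter-∣≡sum-divisorTerm z ds

sum-map-suc-upTo : ∀ N f → sum (map f (map suc (upTo N))) ≡ sumTo N f
sum-map-suc-upTo zero    f = refl
sum-map-suc-upTo (suc N) f = begin
  sum (map f (map suc (upTo (suc N))))
    ≡⟨ cong (λ ns → sum (map f (map suc ns))) (sym (upTo-∷ʳ N)) ⟩
  sum (map f (map suc (upTo N ∷ʳ N)))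
    ≡⟨ cong (λ ns → sum (map f ns)) (map-++ suc (upTo N) [ N ]) ⟩
  sum (map f (map suc (upTo N) ∷ʳ suc N))
    ≡⟨ cong sum (map-++ f (map suc (upTo N)) [ suc N ]) ⟩
  sum (map f (map suc (upTo N)) ∷ʳ f (suc N))
    ≡⟨ sum-++ (map f (map suc (upTo N))) [ f (suc N) ] ⟩
  sum (map f (map suc (upTo N))) + (f (suc N) + 0)
    ≡⟨ cong₂ _+_ (sum-map-suc-upTo N f) (+-identityʳ _) ⟩
  sumTo N f + f (suc N) ∎
  where open ≡-Reasoning

σ≡sumTo-divisorTerm : ∀ z → σ z ≡ sumTo z (divisorTerm z)
σ≡sumTo-divisorTerm z =
  trans (sum-filter-∣≡sum-divisorTerm z (map suc (upTo z))) (sum-map-suc-upTo z (divisorTerm z))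

sumTo-cong : ∀ N {f g} → (∀ d → f d ≡ g d) → sumTo N f ≡ sumTo N g
sumTo-cong zero    f≗g = refl
sumTo-cong (suc N) f≗g = cong₂ _+_ (sumTo-cong N f≗g) (f≗g (suc N))

sumTo-distrib-+ : ∀ N f g → sumTo N (λ d → f d + g d) ≡ sumTo N f + sumTo N g
sumTo-distrib-+ zero    f g = refl
sumTo-distrib-+ (suc N) f g = begin
  sumTo N (λ d → f d + g d) + (f (suc N) + g (suc N))
    ≡⟨ cong (_+ (f (suc N) + g (suc N))) (sumTo-distrib-+ N f g) ⟩
  sumTo N f + sumTo N g + (f (suc N) + g (suc N))
    ≡⟨ +-interchange (sumTo N f) (sumTo N g) (f (suc N)) (g (suc N)) ⟩
  sumTo N f + f (suc N) + (sumTo N g + g (suc N)) ∎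
  where
  open ≡-Reasoning
  +-interchange : ∀ a b c d → a + b + (c + d) ≡ a + c + (b + d)
  +-interchange = solve-∀

*-distribˡ-sumTo : ∀ c N f → sumTo N (λ d → c * f d) ≡ c * sumTo N f
*-distribˡ-sumTo c zero    f = sym (*-zeroʳ c)
*-distribˡ-sumTo c (suc N) f =
  trans (cong (_+ c * f (suc N)) (*-distribˡ-sumTo c N f)) (sym (*-distribˡ-+ c (sumTo N f) (f (suc N))))

sumTo-+ : ∀ N K f → sumTo (N + K) f ≡ sumTo N f + sumTo K (λ i → f (N + i))
sumTo-+ N zero    f rewrite +-identityʳ N = sym (+-identityʳ _)
sumTo-+ N (suc K) f = begin
  sumTo (N + suc K) f
    ≡⟨ cong (λ M → sumTo M f) (+-suc N K) ⟩
  sumTo (N + K) f + f (suc (N + K))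
    ≡⟨ cong₂ _+_ (sumTo-+ N K f) (cong f (sym (+-suc N K))) ⟩
  sumTo N f + sumTo K (λ i → f (N + i)) + f (N + suc K)
    ≡⟨ +-assoc (sumTo N f) _ _ ⟩
  sumTo N f + sumTo (suc K) (λ i → f (N + i)) ∎
  where open ≡-Reasoning

sumTo-zero : ∀ N f → (∀ i → 0 < i → i ≤ N → f i ≡ 0) → sumTo N f ≡ 0
sumTo-zero zero    f f≡0 = refl
sumTo-zero (suc N) f f≡0 = cong₂ _+_
  (sumTo-zero N f (λ i 0<i i≤N → f≡0 i 0<i (m≤n⇒m≤1+n i≤N)))
  (f≡0 (suc N) z<s ≤-refl)

sumTo-extend : ∀ {N M} f → N ≤ M → (∀ d → N < d → f d ≡ 0) → sumTo M f ≡ sumTo N f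
sumTo-extend {N} {M} f N≤M f≡0 = begin
  sumTo M f
    ≡⟨ cong (λ K → sumTo K f) (sym (m+[n∸m]≡n N≤M)) ⟩
  sumTo (N + (M ∸ N)) f
    ≡⟨ sumTo-+ N (M ∸ N) f ⟩
  sumTo N f + sumTo (M ∸ N) (λ i → f (N + i))
    ≡⟨ cong (sumTo N f +_) (sumTo-zero (M ∸ N) _ (λ i 0<i _ → f≡0 (N + i) (m<m+n N 0<i))) ⟩
  sumTo N f + 0
    ≡⟨ +-identityʳ _ ⟩
  sumTo N f ∎
  where open ≡-Reasoning

onMultiplesOf-multiple : ∀ c f e → onMultiplesOf c f (c * e) ≡ f (c * e)
onMultiplesOf-multiple c f e with c ∣? c * e
... | yes _   = refl
... | no  c∤ = contradiction (m∣m*n e) c∤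

onMultiplesOf-nonmultiple : ∀ c f {d} → ¬ c ∣ d → onMultiplesOf c f d ≡ 0
onMultiplesOf-nonmultiple c f {d} c∤d with c ∣? d
... | yes c∣d = contradiction c∣d c∤d
... | no  _   = refl

c∤c*M+i : ∀ c M {i} → 0 < i → i < c → ¬ c ∣ c * M + i
c∤c*M+i c M {i} 0<i i<c c∣ = <⇒≱ i<c (∣⇒≤ {{>-nonZero 0<i}} (∣m+n∣m⇒∣n c∣ (m∣m*n M)))

sumTo-multiples : ∀ c .{{_ : NonZero c}} f M →
  sumTo (c * M) (onMultiplesOf c f) ≡ sumTo M (λ e → f (c * e))
sumTo-multiples c f zero rewrite *-zeroʳ c = refl
sumTo-multiples c@(suc c') f (suc M) = begin
  sumTo (c * suc M) F
    ≡⟨ cong (λ N → sumTo N F) c*[1+M]≡c*M+c ⟩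
  sumTo (c * M + c) F
    ≡⟨ sumTo-+ (c * M) c F ⟩
  sumTo (c * M) F + (sumTo c' G + G c)
    ≡⟨ cong₂ _+_ (sumTo-multiples c f M) (cong₂ _+_ (sumTo-zero c' G gap) G[c]≡f[c*[1+M]]) ⟩
  sumTo M (λ e → f (c * e)) + f (c * suc M) ∎
  where
  open ≡-Reasoning
  F G : ℕ → ℕ
  F = onMultiplesOf c f
  G i = F (c * M + i)
  c*[1+M]≡c*M+c : c * suc M ≡ c * M + c
  c*[1+M]≡c*M+c = trans (*-suc c M) (+-comm c (c * M))
  gap : ∀ i → 0 < i → i ≤ c' → G i ≡ 0
  gap i 0<i i≤c' = onMultiplesOf-nonmultiple c f (c∤c*M+i c M 0<i (s≤s i≤c'))
  G[c]≡f[c*[1+M]] : G c ≡ f (c * suc M)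
  G[c]≡f[c*[1+M]] = trans (cong F (sym c*[1+M]≡c*M+c)) (onMultiplesOf-multiple c f (suc M))

divisorTerm-multiple : ∀ c .{{_ : NonZero c}} y e → divisorTerm (c * y) (c * e) ≡ c * divisorTerm y e
divisorTerm-multiple c y e with c * e ∣? c * y | e ∣? y
... | yes _     | yes _   = refl
... | yes ce∣cy | no  e∤y = contradiction (*-cancelˡ-∣ c ce∣cy) e∤y
... | no  ce∤cy | yes e∣y = contradiction (*-monoʳ-∣ c e∣y) ce∤cy
... | no  _     | no  _   = sym (*-zeroʳ c)

divisorTerm-beyond : ∀ z .{{_ : NonZero z}} {d} → z < d → divisorTerm z d ≡ 0
divisorTerm-beyond z {d} z<d with d ∣? z
... | yes d∣z = contradiction (∣⇒≤ d∣z) (<⇒≱ z<d)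
... | no  _   = refl

geometricSum : ℕ → ℕ → ℕ
geometricSum p zero    = 1
geometricSum p (suc k) = 1 + p * geometricSum p k

geometricSum*t%p≡t%p : ∀ p .{{_ : NonZero p}} k t → (geometricSum p k * t) % p ≡ t % p
geometricSum*t%p≡t%p p zero    t = cong (_% p) (*-identityˡ t)
geometricSum*t%p≡t%p p (suc k) t =
  trans (cong (_% p) (expand p (geometricSum p k) t)) ([m+kn]%n≡m%n t (geometricSum p k * t) p)
  where
  expand : ∀ a b c → (1 + a * b) * c ≡ c + b * c * a
  expand = solve-∀

m^2≡m*m : ∀ m → m ^ 2 ≡ m * m
m^2≡m*m m = cong (m *_) (*-identityʳ m)

module _ {p} (prime-p : Prime p) where

  private instance
    p≢0 : NonZero p
    p≢0 = prime⇒nonZero prime-p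

  ∤⇒coprime : ∀ {d} → ¬ p ∣ d → Coprime d p
  ∤⇒coprime p∤d (e∣d , e∣p) with prime⇒irreducible prime-p e∣p
  ... | inj₁ e≡1 = e≡1
  ... | inj₂ refl = contradiction e∣d p∤d

  ∤∧∣p^k*x⇒∣x : ∀ k {d x} → ¬ p ∣ d → d ∣ p ^ k * x → d ∣ x
  ∤∧∣p^k*x⇒∣x zero    {d} {x} _   d∣ = subst (d ∣_) (*-identityˡ x) d∣
  ∤∧∣p^k*x⇒∣x (suc k) {d} {x} p∤d d∣ =
    ∤∧∣p^k*x⇒∣x k p∤d (coprime-divisor (∤⇒coprime p∤d) (subst (d ∣_) (*-assoc p (p ^ k) x) d∣))

  divisorTerm-split : ∀ k {x} → ¬ p ∣ x → ∀ d →
    divisorTerm (p * (p ^ k * x)) d ≡ onMultiplesOf p (divisorTerm (p * (p ^ k * x))) d + divisorTerm x d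
  divisorTerm-split k {x} p∤x d with p ∣? d | d ∣? p * (p ^ k * x) | d ∣? x
  ... | yes p∣d | _       | yes d∣x = contradiction (∣-trans p∣d d∣x) p∤x
  ... | yes _   | _       | no  _   = sym (+-identityʳ _)
  ... | no  p∤d | yes d∣z | no  d∤x =
    contradiction (∤∧∣p^k*x⇒∣x k p∤d (coprime-divisor (∤⇒coprime p∤d) d∣z)) d∤x
  ... | no  _   | no  d∤z | yes d∣x = contradiction (∣n⇒∣m*n p (∣n⇒∣m*n (p ^ k) d∣x)) d∤z
  ... | no  _   | yes _   | yes _   = refl
  ... | no  _   | no  _   | no  _   = refl

  σ-p*[p^k*x] : ∀ k {x} → ¬ p ∣ x → σ (p * (p ^ k * x)) ≡ p * σ (p ^ k * x) + σ x
  σ-p*[p^k*x] k {x} p∤x = begin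
    σ (p * y)
      ≡⟨ σ≡sumTo-divisorTerm (p * y) ⟩
    sumTo (p * y) (divisorTerm (p * y))
      ≡⟨ sumTo-cong (p * y) (divisorTerm-split k p∤x) ⟩
    sumTo (p * y) (λ d → onMultiplesOf p (divisorTerm (p * y)) d + divisorTerm x d)
      ≡⟨ sumTo-distrib-+ (p * y) _ _ ⟩
    sumTo (p * y) (onMultiplesOf p (divisorTerm (p * y))) + sumTo (p * y) (divisorTerm x)
      ≡⟨ cong₂ _+_ multiples-of-p coprime-to-p ⟩
    p * σ y + σ x ∎
    where
    open ≡-Reasoning
    y : ℕ
    y = p ^ k * x
    instance
      x≢0 : NonZero x
      x≢0 = ≢-nonZero (λ x≡0 → p∤x (subst (p ∣_) (sym x≡0) (p ∣0)))
      p^k≢0 : NonZero (p ^ k)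
      p^k≢0 = m^n≢0 p k
    multiples-of-p : sumTo (p * y) (onMultiplesOf p (divisorTerm (p * y))) ≡ p * σ y
    multiples-of-p = begin
      sumTo (p * y) (onMultiplesOf p (divisorTerm (p * y)))
        ≡⟨ sumTo-multiples p (divisorTerm (p * y)) y ⟩
      sumTo y (λ e → divisorTerm (p * y) (p * e))
        ≡⟨ sumTo-cong y (divisorTerm-multiple p y) ⟩
      sumTo y (λ e → p * divisorTerm y e)
        ≡⟨ *-distribˡ-sumTo p y (divisorTerm y) ⟩
      p * sumTo y (divisorTerm y)
        ≡⟨ cong (p *_) (sym (σ≡sumTo-divisorTerm y)) ⟩
      p * σ y ∎
    x≤p*y : x ≤ p * y
    x≤p*y = ≤-trans (m≤n*m x (p ^ k)) (m≤n*m y p)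
    coprime-to-p : sumTo (p * y) (divisorTerm x) ≡ σ x
    coprime-to-p = begin
      sumTo (p * y) (divisorTerm x)
        ≡⟨ sumTo-extend (divisorTerm x) x≤p*y (λ d → divisorTerm-beyond x) ⟩
      sumTo x (divisorTerm x)
        ≡⟨ sym (σ≡sumTo-divisorTerm x) ⟩
      σ x ∎

  σ-p^k*x : ∀ k {x} → ¬ p ∣ x → σ (p ^ k * x) ≡ geometricSum p k * σ x
  σ-p^k*x zero    {x} _   = trans (cong σ (*-identityˡ x)) (sym (*-identityˡ (σ x)))
  σ-p^k*x (suc k) {x} p∤x = begin
    σ (p ^ suc k * x)
      ≡⟨ cong σ (*-assoc p (p ^ k) x) ⟩
    σ (p * (p ^ k * x))
      ≡⟨ σ-p*[p^k*x] k p∤x ⟩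
    p * σ (p ^ k * x) + σ x
      ≡⟨ cong (λ s → p * s + σ x) (σ-p^k*x k p∤x) ⟩
    p * (geometricSum p k * σ x) + σ x
      ≡⟨ horner p (geometricSum p k) (σ x) ⟩
    geometricSum p (suc k) * σ x ∎
    where
    open ≡-Reasoning
    horner : ∀ a b c → a * (b * c) + c ≡ (1 + a * b) * c
    horner = solve-∀

  geometricSum*t≡2x : ∀ k {x t} → ¬ p ∣ x →
    σ (p ^ k * x) ≡ 2 * (p ^ k * x) → σ x ≡ p ^ k * t → geometricSum p k * t ≡ 2 * x
  geometricSum*t≡2x k {x} {t} p∤x σ[p^k*x]≡2p^k*x σx≡p^k*t =
    *-cancelˡ-≡ _ _ (p ^ k) {{m^n≢0 p k}} (begin
      p ^ k * (geometricSum p k * t) ≡⟨ x∙yz≈y∙xz (p ^ k) (geometricSum p k) t ⟩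
      geometricSum p k * (p ^ k * t) ≡⟨ cong (geometricSum p k *_) σx≡p^k*t ⟨
      geometricSum p k * σ x         ≡⟨ σ-p^k*x k p∤x ⟨
      σ (p ^ k * x)                  ≡⟨ σ[p^k*x]≡2p^k*x ⟩
      2 * (p ^ k * x)                ≡⟨ x∙yz≈y∙xz 2 (p ^ k) x ⟩
      p ^ k * (2 * x)                ∎)
    where open ≡-Reasoning

  coprime⇒∤ : ∀ {m} → gcd p m ≡ 1 → ¬ p ∣ m
  coprime⇒∤ gcd≡1 p∣m = ¬prime[1] (subst Prime (gcd≡1⇒coprime gcd≡1 (∣-refl , p∣m)) prime-p)

  ∤⇒∤^2 : ∀ {m} → ¬ p ∣ m → ¬ p ∣ m ^ 2
  ∤⇒∤^2 {m} p∤m p∣m² with euclidsLemma m m prime-p (subst (p ∣_) (m^2≡m*m m) p∣m²)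
  ... | inj₁ p∣m = p∤m p∣m
  ... | inj₂ p∣m = p∤m p∣m

-- For prime p this says that 2 is a quadratic non-residue mod p; quantifying over
-- residues rather than all naturals makes it decidable.
TwoNonResidue : (p : ℕ) .{{_ : NonZero p}} → Set
TwoNonResidue p = ∀ {a} → a < p → ∀ {b} → b < p → (a * a) % p ≡ (2 * (b * b)) % p → b ≡ 0

twoNonResidue? : ∀ p .{{_ : NonZero p}} → Dec (TwoNonResidue p)
twoNonResidue? p =
  allUpTo? (λ a → allUpTo? (λ b → ((a * a) % p ≟ (2 * (b * b)) % p) →-dec (b ≟ 0)) p) p

*-congˡ-% : ∀ {p} .{{_ : NonZero p}} c {x y} → x % p ≡ y % p → (c * x) % p ≡ (c * y) % p
*-congˡ-% {p} c {x} {y} x≡y = begin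
  (c * x) % p             ≡⟨ %-distribˡ-* c x p ⟩
  (c % p * (x % p)) % p   ≡⟨ cong (λ r → (c % p * r) % p) x≡y ⟩
  (c % p * (y % p)) % p   ≡⟨ %-distribˡ-* c y p ⟨
  (c * y) % p             ∎
  where open ≡-Reasoning

twoNonResidue⇒∣ : ∀ {p} .{{_ : NonZero p}} → TwoNonResidue p →
  ∀ s m → (s * s) % p ≡ (2 * (m * m)) % p → p ∣ m
twoNonResidue⇒∣ {p} 2-nonResidue s m s²≡2m² =
  m%n≡0⇒n∣m m p (2-nonResidue (m%n<n s p) (m%n<n m p) (begin
    (s % p * (s % p)) % p         ≡⟨ %-distribˡ-* s s p ⟨
    (s * s) % p                   ≡⟨ s²≡2m² ⟩
    (2 * (m * m)) % p             ≡⟨ *-congˡ-% 2 (%-distribˡ-* m m p) ⟩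
    (2 * (m % p * (m % p))) % p   ∎))
  where open ≡-Reasoning

perfect⇒2-residue : ∀ {p k m s} .{{_ : NonZero p}} → Prime p → gcd p m ≡ 1 →
  σ (p ^ k * m ^ 2) ≡ 2 * (p ^ k * m ^ 2) → σ (m ^ 2) ≡ p ^ k * (s * s) → ¬ TwoNonResidue p
perfect⇒2-residue {p} {k} {m} {s} prime-p gcd≡1 σn≡2n σm²≡p^k*s² 2-nonResidue =
  p∤m (twoNonResidue⇒∣ 2-nonResidue s m (begin
    (s * s) % p                      ≡⟨ geometricSum*t%p≡t%p p k (s * s) ⟨
    (geometricSum p k * (s * s)) % p ≡⟨ cong (_% p) cofactor-identity ⟩
    (2 * m ^ 2) % p                  ≡⟨ cong (λ r → (2 * r) % p) (m^2≡m*m m) ⟩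
    (2 * (m * m)) % p                ∎))
  where
  open ≡-Reasoning
  p∤m : ¬ p ∣ m
  p∤m = coprime⇒∤ prime-p gcd≡1
  cofactor-identity : geometricSum p k * (s * s) ≡ 2 * m ^ 2
  cofactor-identity = geometricSum*t≡2x prime-p k (∤⇒∤^2 prime-p p∤m) σn≡2n σm²≡p^k*s²

prime∧≡1[mod4]⇒5∨13∨≥17 : ∀ p → Prime p → p % 4 ≡ 1 → p ≡ 5 ⊎ p ≡ 13 ⊎ p ≥ 17
prime∧≡1[mod4]⇒5∨13∨≥17 0  _     ()
prime∧≡1[mod4]⇒5∨13∨≥17 1  pr    _ = ⊥-elim (¬prime[1] pr)
prime∧≡1[mod4]⇒5∨13∨≥17 2  _     ()
prime∧≡1[mod4]⇒5∨13∨≥17 3  _     ()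
prime∧≡1[mod4]⇒5∨13∨≥17 4  _     ()
prime∧≡1[mod4]⇒5∨13∨≥17 5  _     _ = inj₁ refl
prime∧≡1[mod4]⇒5∨13∨≥17 6  _     ()
prime∧≡1[mod4]⇒5∨13∨≥17 7  _     ()
prime∧≡1[mod4]⇒5∨13∨≥17 8  _     ()
prime∧≡1[mod4]⇒5∨13∨≥17 9  pr    _ = ⊥-elim (from-no (prime? 9) pr)
prime∧≡1[mod4]⇒5∨13∨≥17 10 _     ()
prime∧≡1[mod4]⇒5∨13∨≥17 11 _     ()
prime∧≡1[mod4]⇒5∨13∨≥17 12 _     ()
prime∧≡1[mod4]⇒5∨13∨≥17 13 _     _ = inj₂ (inj₁ refl)
prime∧≡1[mod4]⇒5∨13∨≥17 14 _     ()
prime∧≡1[mod4]⇒5∨13∨≥17 15 _     ()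
prime∧≡1[mod4]⇒5∨13∨≥17 16 _     ()
prime∧≡1[mod4]⇒5∨13∨≥17 (suc (suc (suc (suc (suc (suc (suc (suc (suc (suc (suc (suc (suc (suc (suc (suc (suc r))))))))))))))))) _ _ =
  inj₂ (inj₂ (m≤m+n 17 r))

theorem3 : (n p k m : ℕ) → 0 < n → n % 2 ≡ 1 → σ n ≡ 2 * n →
    n ≡ p ^ k * m ^ 2 → Prime p → p % 4 ≡ 1 → k % 4 ≡ 1 → gcd p m ≡ 1 →
    ∃ (λ s → σ (m ^ 2) ≡ p ^ k * (s * s)) →
    p ≥ 17
theorem3 _ p k m _ _ σn≡2n refl prime-p p%4≡1 _ gcd≡1 (s , σm²≡p^k*s²)
  with prime∧≡1[mod4]⇒5∨13∨≥17 p prime-p p%4≡1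
... | inj₁ refl =
  ⊥-elim (perfect⇒2-residue {k = k} {m} {s} prime-p gcd≡1 σn≡2n σm²≡p^k*s² (from-yes (twoNonResidue? 5)))
... | inj₂ (inj₁ refl) =
  ⊥-elim (perfect⇒2-residue {k = k} {m} {s} prime-p gcd≡1 σn≡2n σm²≡p^k*s² (from-yes (twoNonResidue? 13)))
... | inj₂ (inj₂ p≥17) = p≥17
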